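{- Let $n,k$ be positive integers and let $G$ be an $n$-vertex tournament which has fewer than $k!$ copies of $T_k$. Then there is a linear ordering $\pi$ of the vertices of $G$ such that $\alpha(G_\pi)\le k$, and consequently $\chi(G_\pi)\ge n/k$.
   Context: A tournament is an orientation of a complete graph. $T_k$ denotes the transitive tournament on $k$ vertices; a copy of $T_k$ in $G$ is a $k$-vertex subset of $V(G)$ inducing a transitive subtournament. For an oriented graph $G$ and a linear ordering $\pi$ of $V(G)$, $G_\pi$ is the subgraph of $G$ on the same vertex set consisting of the edges oriented forwards according to $\pi$ (from the earlier to the later vertex). $\alpha$ and $\chi$ denote the independence number and chromatic number of the underlying undirected graph. -}

module Defs where

open import Data.Nat using (ℕ; zero; suc; _≤_; _*_; _≟_)
open import Data.Fin using (Fin) renaming (_<_ to _<ᶠ_)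
open import Data.Fin.Properties using (all?)
open import Data.Fin.Subset using (Subset; _∈_; ∣_∣)
open import Data.Fin.Subset.Properties using (_∈?_)
open import Data.Fin.Permutation using (Permutation′; _⟨$⟩ʳ_)
open import Data.Bool using (Bool; true; false; T; T?; not)
open import Data.Vec using (Vec; []; _∷_)
open import Data.List using (List; []; _∷_; [_]; map; _++_; filter; length)
open import Data.Product using (_×_)
open import Data.Sum using (_⊎_)
open import Relation.Binary.PropositionalEquality using (_≡_; _≢_)
open import Relation.Nullary using (Dec; ¬_)
open import Relation.Nullary.Decidable using (_→-dec_; _×-dec_)

record Tournament (n : ℕ) : Set where
  field
    E        : Fin n → Fin n → Bool
    loopless : ∀ u → E u u ≡ false
    oriented : ∀ u v → u ≢ v → E v u ≡ not (E u v)
open Tournament public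

allSubsets : (n : ℕ) → List (Subset n)
allSubsets zero    = [ [] ]
allSubsets (suc n) = map (false ∷_) (allSubsets n) ++ map (true ∷_) (allSubsets n)

InducesTransitive : ∀ {n} → Tournament n → Subset n → Set
InducesTransitive G S =
  ∀ a b c → a ∈ S → b ∈ S → c ∈ S → T (E G a b) → T (E G b c) → T (E G a c)

InducesTransitive? : ∀ {n} (G : Tournament n) (S : Subset n) → Dec (InducesTransitive G S)
InducesTransitive? G S =
  all? λ a → all? λ b → all? λ c →
    (a ∈? S) →-dec ((b ∈? S) →-dec ((c ∈? S) →-dec
      (T? (E G a b) →-dec (T? (E G b c) →-dec T? (E G a c)))))

IsCopyOfT : ∀ {n} → Tournament n → ℕ → Subset n → Set
IsCopyOfT G k S = (∣ S ∣ ≡ k) × InducesTransitive G S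

IsCopyOfT? : ∀ {n} (G : Tournament n) (k : ℕ) (S : Subset n) → Dec (IsCopyOfT G k S)
IsCopyOfT? G k S = (∣ S ∣ ≟ k) ×-dec InducesTransitive? G S

numCopiesT : ∀ {n} → Tournament n → ℕ → ℕ
numCopiesT {n} G k = length (filter (IsCopyOfT? G k) (allSubsets n))

-- A linear ordering of Fin n is a permutation π; π ⟨$⟩ʳ u is the position of u.
-- G_π keeps exactly the edges u → v with π(u) < π(v).
-- Underlying undirected adjacency of G_π:
AdjForward : ∀ {n} → Tournament n → Permutation′ n → Fin n → Fin n → Set
AdjForward G π u v =
    (T (E G u v) × (π ⟨$⟩ʳ u) <ᶠ (π ⟨$⟩ʳ v))
  ⊎ (T (E G v u) × (π ⟨$⟩ʳ v) <ᶠ (π ⟨$⟩ʳ u))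

IndependentIn : ∀ {n} → Tournament n → Permutation′ n → Subset n → Set
IndependentIn G π S = ∀ u v → u ∈ S → v ∈ S → ¬ AdjForward G π u v

IndepNumberAtMost : ∀ {n} → Tournament n → Permutation′ n → ℕ → Set
IndepNumberAtMost G π k = ∀ S → IndependentIn G π S → ∣ S ∣ ≤ k

ProperColouring : ∀ {n} → Tournament n → Permutation′ n → (m : ℕ) → (Fin n → Fin m) → Set
ProperColouring G π m c = ∀ u v → AdjForward G π u v → c u ≢ c v

ChromaticAtLeastDiv : ∀ {n} → Tournament n → Permutation′ n → ℕ → Set
ChromaticAtLeastDiv {n} G π k =
  ∀ m (c : Fin n → Fin m) → ProperColouring G π m c → n ≤ m * k

module Submission where

-- Order the vertices uniformly at random. A fixed copy of T_k ends up backward (every edge points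
-- from a later to an earlier vertex) with probability 1/k!, so fewer than k! copies means that some
-- ordering has no backward copy. We find one by conditional expectations: positions n-1, n-2, …, 0
-- are filled in turn, and when positions ≥ m are settled a copy C with j vertices at positions < m
-- is still alive iff none of its edges into a settled vertex points forward; it then becomes
-- backward with conditional probability 1/j!. The potential adds k!/j! over the live copies, i.e.
-- k! times the conditional expectation, so some choice of the vertex for position m-1 does not
-- increase it; it starts at the number of copies and ends, below k!, counting k! per backward copy.
-- In the final ordering π an independent set of G_π has all its edges backward, so it induces a
-- transitive tournament and has fewer than k vertices; colour classes then give χ(G_π) ≥ n/k.

open import Defs
open import Data.Bool using (true; false; if_then_else_; T; T?; not)
open import Data.Fin as Fin using (Fin; toℕ; fromℕ<) renaming (zero to fzero; suc to fsuc)
open import Data.Fin.Permutation as P using (Permutation′; _⟨$⟩ʳ_; _⟨$⟩ˡ_; _∘ₚ_)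
import Data.Fin.Permutation.Components as PC
open import Data.Fin.Properties using (all?; any?; toℕ-injective; toℕ-fromℕ<; toℕ<n)
  renaming (suc-injective to fsuc-injective)
open import Data.Fin.Subset using (Subset; _∈_; _∉_; _⊆_; ∣_∣; inside; outside)
open import Data.Fin.Subset.Properties using (_∈?_)
open import Data.List as List using (List; filter)
open import Data.List.Membership.Propositional using () renaming (_∈_ to _∈ₗ_)
open import Data.List.Membership.Propositional.Properties
  using (∈-filter⁻; ∈-filter⁺; ∈-lookup; ∈-++⁺ˡ; ∈-++⁺ʳ; ∈-map⁺)
open import Data.List.Relation.Unary.Any using (here; index)
open import Data.List.Relation.Unary.Any.Properties using (lookup-index)
open import Data.Nat using (ℕ; zero; suc; _+_; _*_; _∸_; _≤_; _<_; z≤n; s≤s; _!; _≤?_; _<?_)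
open import Data.Nat.Combinatorics.Base using (_P′_)
open import Data.Nat.Combinatorics.Specification using (nP′k≡n!/[n∸k]!)
open import Data.Nat.DivMod using (_/_; /-congʳ; n/1≡n)
open import Data.Nat.Properties
open import Data.Product using (Σ; ∃; _×_; _,_; proj₁; proj₂; map₂)
open import Data.Sum using (_⊎_; inj₁; inj₂)
open import Data.Vec using ([]; _∷_; tabulate; here; there)
open import Function using (_∘_)
open import Function.Bundles using (Injection)
open import Function.Properties.Inverse using (↔⇒↣)
open import Level using (Level; 0ℓ)
open import Relation.Binary.Definitions using (tri<; tri≈; tri>)
open import Relation.Binary.PropositionalEquality
open import Relation.Nullary using (Dec; yes; no; does; ¬_; ¬?; contradiction)
open import Relation.Nullary.Decidable using (_×-dec_; _→-dec_)
open import Relation.Unary using (Pred; Decidable)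

open import Algebra.Properties.Semiring.Sum +-*-semiring
  using (sum; sum-syntax; sum-cong-≗; ∑-distrib-+; ∑-comm; *-distribˡ-sum; *-distribʳ-sum)

private variable
  p q : Level
  A B : Set p
  n   : ℕ

𝟙 : Dec A → ℕ
𝟙 d = if does d then 1 else 0

𝟙-yes : (d : Dec A) → A → 𝟙 d ≡ 1
𝟙-yes (yes _) _ = refl
𝟙-yes (no ¬a) a = contradiction a ¬a

𝟙-no : (d : Dec A) → ¬ A → 𝟙 d ≡ 0
𝟙-no (yes a) ¬a = contradiction a ¬a
𝟙-no (no _)  _  = refl

𝟙-mono : (d : Dec A) (e : Dec B) → (A → B) → 𝟙 d ≤ 𝟙 e
𝟙-mono (yes a) e f = ≤-reflexive (sym (𝟙-yes e (f a)))
𝟙-mono (no _)  _ _ = z≤n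

𝟙-cong : (d : Dec A) (e : Dec B) → (A → B) → (B → A) → 𝟙 d ≡ 𝟙 e
𝟙-cong d e f g = ≤-antisym (𝟙-mono d e f) (𝟙-mono e d g)

𝟙*-≤ : (d : Dec A) (x : ℕ) → 𝟙 d * x ≤ x
𝟙*-≤ (yes _) x = ≤-reflexive (+-identityʳ x)
𝟙*-≤ (no  _) x = z≤n

∑-mono-≤ : {f g : Fin n → ℕ} → (∀ i → f i ≤ g i) → sum f ≤ sum g
∑-mono-≤ {n = zero}  _   = z≤n
∑-mono-≤ {n = suc n} f≤g = +-mono-≤ (f≤g fzero) (∑-mono-≤ (f≤g ∘ fsuc))

∑-const : ∀ n c → ∑[ i < n ] c ≡ n * c
∑-const zero    c = refl
∑-const (suc n) c = cong (c +_) (∑-const n c)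

∑-zero : ∀ n → ∑[ i < n ] 0 ≡ 0
∑-zero n = trans (∑-const n 0) (*-zeroʳ n)

term≤∑ : (f : Fin n → ℕ) (i : Fin n) → f i ≤ sum f
term≤∑ f fzero    = m≤m+n _ _
term≤∑ f (fsuc i) = ≤-trans (term≤∑ (f ∘ fsuc) i) (m≤n+m _ (f fzero))

count : {P : Pred (Fin n) p} → Decidable P → ℕ
count P? = ∑[ i < _ ] 𝟙 (P? i)

count-≡ : (v : Fin n) → count (Fin._≟ v) ≡ 1
count-≡ {suc n} fzero    =
  cong suc (trans (sum-cong-≗ {n} λ i → 𝟙-no (fsuc i Fin.≟ fzero) λ ()) (∑-zero n))
count-≡ {suc n} (fsuc v) = count-≡ v

count-≤1 : {P : Pred (Fin n) p} (P? : Decidable P) → (∀ {u v} → P u → P v → u ≡ v) → count P? ≤ 1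
count-≤1 {n = zero}  P? unique = z≤n
count-≤1 {n = suc n} {P = P} P? unique with P? fzero
... | yes p₀ =
  ≤-reflexive (cong suc (trans (sum-cong-≗ {n} λ i → 𝟙-no (P? (fsuc i)) (others i)) (∑-zero n)))
  where
  others : ∀ i → ¬ P (fsuc i)
  others i pᵢ with () ← unique p₀ pᵢ
... | no _   = count-≤1 (P? ∘ fsuc) (λ pu pv → fsuc-injective (unique pu pv))

count-split : {P : Pred (Fin n) p} {Q : Pred (Fin n) q} (P? : Decidable P) (Q? : Decidable Q) →
              count (λ u → P? u ×-dec ¬? (Q? u)) + count (λ u → Q? u ×-dec P? u) ≡ count P?
count-split {n = n} P? Q? =
  trans (sym (∑-distrib-+ (λ u → 𝟙 (P? u ×-dec ¬? (Q? u))) (λ u → 𝟙 (Q? u ×-dec P? u))))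
        (sum-cong-≗ {n} pointwise)
  where
  pointwise : ∀ u → 𝟙 (P? u ×-dec ¬? (Q? u)) + 𝟙 (Q? u ×-dec P? u) ≡ 𝟙 (P? u)
  pointwise u with P? u | Q? u
  ... | yes _ | yes _ = refl
  ... | yes _ | no  _ = refl
  ... | no  _ | yes _ = refl
  ... | no  _ | no  _ = refl

∃-≤-average : {P : Pred (Fin n) p} (P? : Decidable P) (f : Fin n → ℕ) (b : ℕ) →
              ∃ P → ∑[ i < n ] (𝟙 (P? i) * f i) ≤ count P? * b → ∃ λ i → P i × f i ≤ b
∃-≤-average {n = n} P? f b (i₀ , pᵢ₀) ∑≤ with any? (λ i → P? i ×-dec (f i ≤? b))
... | yes witness = witness
... | no  none    = contradiction ∑≤ (<⇒≱ (begin-strict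
  count P? * b                   <⟨ m<m+n (count P? * b) 0<count ⟩
  count P? * b + count P?        ≡⟨ +-comm (count P? * b) (count P?) ⟩
  count P? + count P? * b        ≡⟨ *-suc (count P?) b ⟨
  count P? * suc b               ≡⟨ *-comm (count P?) (suc b) ⟩
  suc b * count P?               ≡⟨ *-distribˡ-sum (suc b) (𝟙 ∘ P?) ⟩
  ∑[ i < n ] (suc b * 𝟙 (P? i))  ≤⟨ ∑-mono-≤ above ⟩
  ∑[ i < n ] (𝟙 (P? i) * f i)    ∎))
  where
  open ≤-Reasoning
  0<count : 0 < count P?
  0<count = ≤-trans (≤-reflexive (sym (𝟙-yes (P? i₀) pᵢ₀))) (term≤∑ (𝟙 ∘ P?) i₀)
  above : ∀ i → suc b * 𝟙 (P? i) ≤ 𝟙 (P? i) * f i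
  above i with P? i
  ... | yes pᵢ = subst₂ _≤_ (sym (*-identityʳ (suc b))) (sym (*-identityˡ (f i)))
                         (≰⇒> λ fᵢ≤b → none (i , pᵢ , fᵢ≤b))
  ... | no  _  = ≤-reflexive (*-zeroʳ b)

∣p∣≡count : (S : Subset n) → ∣ S ∣ ≡ count (_∈? S)
∣p∣≡count []          = refl
∣p∣≡count (true  ∷ S) = cong suc (∣p∣≡count S)
∣p∣≡count (false ∷ S) = ∣p∣≡count S

toSubset : {P : Pred (Fin n) p} → Decidable P → Subset n
toSubset P? = tabulate (does ∘ P?)

∈-toSubset⁺ : ∀ {P : Pred (Fin n) p} (P? : Decidable P) {u} → P u → u ∈ toSubset P?
∈-toSubset⁺ {n = suc n} P? {fzero} pu with P? fzero
... | yes _  = here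
... | no ¬pu = contradiction pu ¬pu
∈-toSubset⁺ {n = suc n} P? {fsuc u} pu = there (∈-toSubset⁺ (P? ∘ fsuc) pu)

∈-toSubset⁻ : ∀ {P : Pred (Fin n) p} (P? : Decidable P) {u} → u ∈ toSubset P? → P u
∈-toSubset⁻ {n = suc n} P? {fzero} u∈ with P? fzero | u∈
... | yes pu | _  = pu
... | no  _  | ()
∈-toSubset⁻ {n = suc n} P? {fsuc u} (there u∈) = ∈-toSubset⁻ (P? ∘ fsuc) u∈

∣toSubset∣ : {P : Pred (Fin n) p} (P? : Decidable P) → ∣ toSubset P? ∣ ≡ count P?
∣toSubset∣ {n = n} P? = trans (∣p∣≡count (toSubset P?))
  (sum-cong-≗ {n} λ u → 𝟙-cong (u ∈? toSubset P?) (P? u) (∈-toSubset⁻ P?) (∈-toSubset⁺ P?))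

⊆-of-size : (S : Subset n) (k : ℕ) → k ≤ ∣ S ∣ → ∃ λ C → C ⊆ S × ∣ C ∣ ≡ k
⊆-of-size []          zero    _        = [] , (λ ()) , refl
⊆-of-size (_ ∷ S)     zero    _        with C , C⊆S , ∣C∣≡0 ← ⊆-of-size S zero z≤n =
  outside ∷ C , (λ { (there x∈) → there (C⊆S x∈) }) , ∣C∣≡0
⊆-of-size (true ∷ S)  (suc k) (s≤s k≤) with C , C⊆S , ∣C∣≡k ← ⊆-of-size S k k≤ =
  inside ∷ C , (λ { here → here ; (there x∈) → there (C⊆S x∈) }) , cong suc ∣C∣≡k
⊆-of-size (false ∷ S) (suc k) k<       with C , C⊆S , ∣C∣≡k ← ⊆-of-size S (suc k) k< =
  outside ∷ C , (λ { (there x∈) → there (C⊆S x∈) }) , ∣C∣≡k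

allSubsets-complete : (S : Subset n) → S ∈ₗ allSubsets n
allSubsets-complete []                      = here refl
allSubsets-complete {suc n} (false ∷ S) = ∈-++⁺ˡ (∈-map⁺ (false ∷_) (allSubsets-complete S))
allSubsets-complete {suc n} (true  ∷ S) =
  ∈-++⁺ʳ (List.map (false ∷_) (allSubsets n)) (∈-map⁺ (true ∷_) (allSubsets-complete S))

fibre : ∀ {m} → (Fin n → Fin m) → Fin m → Subset n
fibre c i = toSubset (λ u → c u Fin.≟ i)

∑-∣fibre∣ : ∀ {m} (c : Fin n → Fin m) → ∑[ i < m ] ∣ fibre c i ∣ ≡ n
∑-∣fibre∣ {n} {m} c = begin
  ∑[ i < m ] ∣ fibre c i ∣
    ≡⟨ sum-cong-≗ {m} (λ i → ∣toSubset∣ (λ u → c u Fin.≟ i)) ⟩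
  ∑[ i < m ] ∑[ u < n ] 𝟙 (c u Fin.≟ i)
    ≡⟨ ∑-comm (λ i u → 𝟙 (c u Fin.≟ i)) ⟩
  ∑[ u < n ] ∑[ i < m ] 𝟙 (c u Fin.≟ i)
    ≡⟨ sum-cong-≗ {n} (λ u → trans (sum-cong-≗ {m} (flip-≟ u)) (count-≡ (c u))) ⟩
  ∑[ u < n ] 1
    ≡⟨ trans (∑-const n 1) (*-identityʳ n) ⟩
  n ∎
  where
  open ≡-Reasoning
  flip-≟ : ∀ u i → 𝟙 (c u Fin.≟ i) ≡ 𝟙 (i Fin.≟ c u)
  flip-≟ u i = 𝟙-cong (c u Fin.≟ i) (i Fin.≟ c u) sym sym

fibres≤⇒n≤m*k : ∀ {m k} (c : Fin n → Fin m) → (∀ i → ∣ fibre c i ∣ ≤ k) → n ≤ m * k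
fibres≤⇒n≤m*k {n} {m} {k} c ∣fibre∣≤k = begin
  n                         ≡⟨ ∑-∣fibre∣ c ⟨
  ∑[ i < m ] ∣ fibre c i ∣  ≤⟨ ∑-mono-≤ ∣fibre∣≤k ⟩
  ∑[ i < m ] k              ≡⟨ ∑-const m k ⟩
  m * k                     ∎
  where open ≤-Reasoning

-- weight k j = k!/j!
weight : ℕ → ℕ → ℕ
weight k j = k P′ (k ∸ j)

weight-zero : ∀ k → weight k 0 ≡ k !
weight-zero k = begin
  k P′ k           ≡⟨ nP′k≡n!/[n∸k]! (≤-refl {k}) ⟩
  k ! / (k ∸ k) !  ≡⟨ /-congʳ (cong _! (n∸n≡0 k)) ⟩
  k ! / 1          ≡⟨ n/1≡n (k !) ⟩
  k !              ∎
  where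
  open ≡-Reasoning
  instance _ = (k ∸ k) !≢0

weight-self : ∀ k → weight k k ≡ 1
weight-self k = cong (k P′_) (n∸n≡0 k)

weight-suc : ∀ {k j} → j < k → weight k j ≡ suc j * weight k (suc j)
weight-suc {k} {j} j<k = begin
  k P′ (k ∸ j)                            ≡⟨ cong (k P′_) (+-∸-assoc 1 j<k) ⟩
  (k ∸ (k ∸ suc j)) * (k P′ (k ∸ suc j))  ≡⟨ cong (_* (k P′ (k ∸ suc j))) (m∸[m∸n]≡n j<k) ⟩
  suc j * (k P′ (k ∸ suc j))              ∎
  where open ≡-Reasoning

weight-pred-≤ : ∀ {k j d} → j ≤ k → d ≤ 1 → d ≤ j → d * weight k (j ∸ 1) ≤ j * weight k j
weight-pred-≤ {d = zero}                 _   _        _ = z≤n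
weight-pred-≤ {k} {suc j} {d = suc zero} j<k _        _ = ≤-reflexive (trans (*-identityˡ _) (weight-suc j<k))
weight-pred-≤ {d = suc (suc _)}          _   (s≤s ()) _

transpose-cases : (i j x : Fin n) → let y = PC.transpose i j x in y ≡ i ⊎ y ≡ j ⊎ y ≡ x
transpose-cases i j x with x Fin.≟ i
... | yes _ = inj₂ (inj₁ refl)
... | no  _ with x Fin.≟ j
...   | yes _ = inj₁ refl
...   | no  _ = inj₂ (inj₂ refl)

transpose-fixes : (i j x : Fin n) → x ≢ i → x ≢ j → PC.transpose i j x ≡ x
transpose-fixes i j x x≢i x≢j with x Fin.≟ i
... | yes x≡i = contradiction x≡i x≢i
... | no  _ with x Fin.≟ j
...   | yes x≡j = contradiction x≡j x≢j
...   | no  _   = refl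

transpose-maps : (i j : Fin n) → PC.transpose i j i ≡ j
transpose-maps i j with i Fin.≟ i
... | yes _   = refl
... | no  i≢i = contradiction refl i≢i

module Orderings {n} (G : Tournament n) where

  position : Permutation′ n → Fin n → ℕ
  position σ u = toℕ (σ ⟨$⟩ʳ u)

  position-injective : ∀ σ {u v} → position σ u ≡ position σ v → u ≡ v
  position-injective σ = Injection.injective (↔⇒↣ σ) ∘ toℕ-injective

  Backward : Permutation′ n → Subset n → Set
  Backward σ S = ∀ u v → u ∈ S → v ∈ S → T (E G u v) → position σ v < position σ u

  -- Positions ≥ m are settled; the vertices at positions < m are free.
  Survives : Permutation′ n → ℕ → Subset n → Set
  Survives σ m C =
    ∀ u v → u ∈ C → v ∈ C → T (E G u v) → m ≤ position σ v → position σ v < position σ u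

  survives? : ∀ σ m C → Dec (Survives σ m C)
  survives? σ m C = all? λ u → all? λ v → (u ∈? C) →-dec ((v ∈? C) →-dec
    (T? (E G u v) →-dec ((m ≤? position σ v) →-dec (position σ v <? position σ u))))

  freeIn : Permutation′ n → ℕ → Subset n → ℕ
  freeIn σ m C = count (λ u → (u ∈? C) ×-dec (position σ u <? m))

  moveTo : Permutation′ n → ∀ {m} → m < n → Fin n → Permutation′ n
  moveTo σ m<n v = σ ∘ₚ P.transpose (σ ⟨$⟩ʳ v) (fromℕ< m<n)

  module Move (σ : Permutation′ n) {m} (m<n : m < n) {v} (v-free : position σ v < suc m) where

    σ′ : Permutation′ n
    σ′ = moveTo σ m<n v

    position-placed : ∀ {w} → suc m ≤ position σ w → position σ′ w ≡ position σ w
    position-placed {w} m<w = cong toℕ (transpose-fixes _ _ _ σw≢σv σw≢m)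
      where
      σw≢σv : σ ⟨$⟩ʳ w ≢ σ ⟨$⟩ʳ v
      σw≢σv eq = <⇒≱ v-free (subst (suc m ≤_) (cong toℕ eq) m<w)
      σw≢m : σ ⟨$⟩ʳ w ≢ fromℕ< m<n
      σw≢m eq = <-irrefl (sym (toℕ-fromℕ< m<n)) (subst (suc m ≤_) (cong toℕ eq) m<w)

    position-free : ∀ {u} → position σ u < suc m → position σ′ u < suc m
    position-free {u} u-free with transpose-cases (σ ⟨$⟩ʳ v) (fromℕ< m<n) (σ ⟨$⟩ʳ u)
    ... | inj₁ eq        = subst (_< suc m) (sym (cong toℕ eq)) v-free
    ... | inj₂ (inj₁ eq) = subst (_< suc m) (sym (trans (cong toℕ eq) (toℕ-fromℕ< m<n))) ≤-refl
    ... | inj₂ (inj₂ eq) = subst (_< suc m) (sym (cong toℕ eq)) u-free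

    position-unchanged : ∀ {u} → suc m ≤ position σ′ u → position σ′ u ≡ position σ u
    position-unchanged {u} m<u with suc m ≤? position σ u
    ... | yes m<u′ = position-placed m<u′
    ... | no  u≤m  = contradiction m<u (<⇒≱ (position-free (≰⇒> u≤m)))

    position-moved : position σ′ v ≡ m
    position-moved = trans (cong toℕ (transpose-maps (σ ⟨$⟩ʳ v) (fromℕ< m<n))) (toℕ-fromℕ< m<n)

    position-others : ∀ {u} → position σ u < suc m → u ≢ v → position σ′ u < m
    position-others u-free u≢v with m<1+n⇒m<n∨m≡n (position-free u-free)
    ... | inj₁ u<m = u<m
    ... | inj₂ u≡m = contradiction (position-injective σ′ (trans u≡m (sym position-moved))) u≢v

    survives-before : ∀ {C} → Survives σ′ m C → Survives σ (suc m) C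
    survives-before survives u w u∈ w∈ u→w m<w = subst₂ _<_ w-same (position-unchanged m<u′) w<u′
      where
      w-same : position σ′ w ≡ position σ w
      w-same = position-placed m<w
      m<w′ : suc m ≤ position σ′ w
      m<w′ = subst (suc m ≤_) (sym w-same) m<w
      w<u′ : position σ′ w < position σ′ u
      w<u′ = survives u w u∈ w∈ u→w (≤-trans (n≤1+n m) m<w′)
      m<u′ : suc m ≤ position σ′ u
      m<u′ = <-trans m<w′ w<u′

    in-neighbours-placed : ∀ {C u} → v ∈ C → Survives σ′ m C → u ∈ C → T (E G u v) →
                           suc m ≤ position σ u
    in-neighbours-placed {u = u} v∈ survives u∈ u→v = subst (suc m ≤_) (position-unchanged m<u′) m<u′
      where
      m<u′ : m < position σ′ u
      m<u′ = subst (_< position σ′ u) position-moved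
                   (survives u v u∈ v∈ u→v (≤-reflexive (sym position-moved)))

    freeIn-moved : ∀ C → freeIn σ′ m C + 𝟙 (v ∈? C) ≡ freeIn σ (suc m) C
    freeIn-moved C = begin
      freeIn σ′ m C + 𝟙 (v ∈? C)
        ≡⟨ cong (freeIn σ′ m C +_) (trans (cong (_* 𝟙 (v ∈? C)) (count-≡ v)) (*-identityˡ _)) ⟨
      freeIn σ′ m C + count (Fin._≟ v) * 𝟙 (v ∈? C)
        ≡⟨ cong (freeIn σ′ m C +_) (*-distribʳ-sum (𝟙 (v ∈? C)) (𝟙 ∘ (Fin._≟ v))) ⟩
      freeIn σ′ m C + ∑[ u < n ] (𝟙 (u Fin.≟ v) * 𝟙 (v ∈? C))
        ≡⟨ ∑-distrib-+ free′ (λ u → 𝟙 (u Fin.≟ v) * 𝟙 (v ∈? C)) ⟨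
      ∑[ u < n ] (free′ u + 𝟙 (u Fin.≟ v) * 𝟙 (v ∈? C))
        ≡⟨ sum-cong-≗ {n} pointwise ⟩
      freeIn σ (suc m) C
        ∎
      where
      open ≡-Reasoning
      free′ : Fin n → ℕ
      free′ u = 𝟙 ((u ∈? C) ×-dec (position σ′ u <? m))
      pointwise : ∀ u → free′ u + 𝟙 (u Fin.≟ v) * 𝟙 (v ∈? C)
                      ≡ 𝟙 ((u ∈? C) ×-dec (position σ u <? suc m))
      pointwise u with u Fin.≟ v
      ... | yes refl =
        cong₂ _+_ (𝟙-no ((v ∈? C) ×-dec (position σ′ v <? m)) λ (_ , v<m) → <-irrefl position-moved v<m)
                  (trans (*-identityˡ _)
                         (𝟙-cong (v ∈? C) ((v ∈? C) ×-dec (position σ v <? suc m)) (_, v-free) proj₁))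
      ... | no u≢v = trans (+-identityʳ _)
        (𝟙-cong ((u ∈? C) ×-dec (position σ′ u <? m)) ((u ∈? C) ×-dec (position σ u <? suc m))
                (λ (u∈ , u<m) → u∈ , was-free u<m) (λ (u∈ , u-free) → u∈ , position-others u-free u≢v))
        where
        was-free : position σ′ u < m → position σ u < suc m
        was-free u<m = ≰⇒> λ m<u → <⇒≱ (m<n⇒m<1+n u<m) (subst (suc m ≤_) (sym (position-placed m<u)) m<u)

  module Potential (k : ℕ) where

    value : Permutation′ n → ℕ → Subset n → ℕ
    value σ m C = 𝟙 (survives? σ m C) * weight k (freeIn σ m C)

    value≤weight : ∀ σ m C → value σ m C ≤ weight k (freeIn σ m C)
    value≤weight σ m C = 𝟙*-≤ (survives? σ m C) (weight k (freeIn σ m C))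

    freeIn≤size : ∀ σ m C → freeIn σ m C ≤ ∣ C ∣
    freeIn≤size σ m C =
      ≤-trans (∑-mono-≤ λ u → 𝟙-mono ((u ∈? C) ×-dec (position σ u <? m)) (u ∈? C) proj₁)
              (≤-reflexive (sym (∣p∣≡count C)))

    copies : List (Subset n)
    copies = filter (IsCopyOfT? G k) (allSubsets n)

    copy-size : ∀ i → ∣ List.lookup copies i ∣ ≡ k
    copy-size i = proj₁ (proj₂ (∈-filter⁻ (IsCopyOfT? G k) {xs = allSubsets n} (∈-lookup i)))

    potential : Permutation′ n → ℕ → ℕ
    potential σ m = ∑[ i < numCopiesT G k ] value σ m (List.lookup copies i)

    module Step (σ : Permutation′ n) {m} (m<n : m < n) where

      free? : Decidable (λ v → position σ v < suc m)
      free? v = position σ v <? suc m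

      moved : Fin n → Permutation′ n
      moved = moveTo σ m<n

      Source : Subset n → Pred (Fin n) 0ℓ
      Source C v = v ∈ C × position σ v < suc m × Survives (moved v) m C

      source? : ∀ C → Decidable (Source C)
      source? C v = (v ∈? C) ×-dec free? v ×-dec survives? (moved v) m C

      sources-unique : ∀ {C u v} → Source C u → Source C v → u ≡ v
      sources-unique {C} {u} {v} (u∈ , u-free , survives-u) (v∈ , v-free , survives-v) with u Fin.≟ v
      ... | yes u≡v = u≡v
      ... | no  u≢v with E G u v in u→v
      ...   | true  = contradiction (Move.in-neighbours-placed σ m<n v-free v∈ survives-v u∈ (subst T (sym u→v) _))
                                    (<⇒≱ u-free)
      ...   | false = contradiction (Move.in-neighbours-placed σ m<n u-free u∈ survives-u v∈ v→u)
                                    (<⇒≱ v-free)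
        where
        v→u : T (E G v u)
        v→u = subst T (sym (trans (oriented G u v u≢v) (cong not u→v))) _

      value-moved≤ : ∀ C v →
        𝟙 (free? v) * value (moved v) m C
          ≤ 𝟙 (free? v ×-dec ¬? (v ∈? C)) * weight k (freeIn σ (suc m) C)
            + 𝟙 (source? C v) * weight k (freeIn σ (suc m) C ∸ 1)
      value-moved≤ C v = bound (free? v) (v ∈? C)
        where
        open ≤-Reasoning
        j = freeIn σ (suc m) C
        bound : (v-free? : Dec (position σ v < suc m)) (v∈? : Dec (v ∈ C)) →
                𝟙 v-free? * value (moved v) m C
                  ≤ 𝟙 (v-free? ×-dec ¬? v∈?) * weight k j + 𝟙 (source? C v) * weight k (j ∸ 1)
        bound (no  _)      _        = z≤n
        bound (yes v-free) (no v∉)  = begin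
          1 * value (moved v) m C          ≡⟨ *-identityˡ _ ⟩
          value (moved v) m C              ≤⟨ value≤weight (moved v) m C ⟩
          weight k (freeIn (moved v) m C)  ≡⟨ cong (weight k) same ⟩
          weight k j                       ≡⟨ *-identityˡ _ ⟨
          1 * weight k j                   ≤⟨ m≤m+n _ _ ⟩
          _                                ∎
          where
          same : freeIn (moved v) m C ≡ j
          same = trans (sym (+-identityʳ _))
                       (trans (cong (freeIn (moved v) m C +_) (sym (𝟙-no (v ∈? C) v∉)))
                              (Move.freeIn-moved σ m<n v-free C))
        bound (yes v-free) (yes v∈) = begin
          1 * value (moved v) m C
            ≡⟨ *-identityˡ _ ⟩
          𝟙 (survives? (moved v) m C) * weight k (freeIn (moved v) m C)
            ≤⟨ *-monoˡ-≤ _ (𝟙-mono (survives? (moved v) m C) (source? C v) λ s → v∈ , v-free , s) ⟩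
          𝟙 (source? C v) * weight k (freeIn (moved v) m C)
            ≡⟨ cong (λ i → 𝟙 (source? C v) * weight k i) one-less ⟩
          𝟙 (source? C v) * weight k (j ∸ 1)
            ≤⟨ m≤n+m _ _ ⟩
          _ ∎
          where
          one-less : freeIn (moved v) m C ≡ j ∸ 1
          one-less = trans (sym (m+n∸n≡m _ 1))
            (cong (_∸ 1) (trans (cong (freeIn (moved v) m C +_) (sym (𝟙-yes (v ∈? C) v∈)))
                                (Move.freeIn-moved σ m<n v-free C)))

      -- Moving a free non-member v keeps the weight k!/j!; moving a free member v multiplies it by j,
      -- but C survives that only when v is the source of C's free part, so for at most one v.
      ∑-value-moved≤ : ∀ C → ∣ C ∣ ≡ k →
        ∑[ v < n ] (𝟙 (free? v) * value (moved v) m C) ≤ count free? * value σ (suc m) C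
      ∑-value-moved≤ C ∣C∣≡k = bound (survives? σ (suc m) C)
        where
        open ≤-Reasoning
        j  = freeIn σ (suc m) C
        w  = weight k j
        w′ = weight k (j ∸ 1)
        nonmember? : Decidable (λ v → position σ v < suc m × v ∉ C)
        nonmember? v = free? v ×-dec ¬? (v ∈? C)
        bound : (s? : Dec (Survives σ (suc m) C)) →
                ∑[ v < n ] (𝟙 (free? v) * value (moved v) m C) ≤ count free? * (𝟙 s? * w)
        bound (no dead) =
          ≤-trans (≤-reflexive (trans (sum-cong-≗ {n} λ v → vanishes (free? v)) (∑-zero n))) z≤n
          where
          vanishes : ∀ {v} (v-free? : Dec (position σ v < suc m)) → 𝟙 v-free? * value (moved v) m C ≡ 0
          vanishes (no  _)          = refl
          vanishes {v} (yes v-free) = trans (*-identityˡ _) (cong (_* weight k (freeIn (moved v) m C))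
            (𝟙-no (survives? (moved v) m C) (dead ∘ Move.survives-before σ m<n v-free)))
        bound (yes _) = begin
          ∑[ v < n ] (𝟙 (free? v) * value (moved v) m C)
            ≤⟨ ∑-mono-≤ (value-moved≤ C) ⟩
          ∑[ v < n ] (𝟙 (nonmember? v) * w + 𝟙 (source? C v) * w′)
            ≡⟨ ∑-distrib-+ (λ v → 𝟙 (nonmember? v) * w) (λ v → 𝟙 (source? C v) * w′) ⟩
          ∑[ v < n ] (𝟙 (nonmember? v) * w) + ∑[ v < n ] (𝟙 (source? C v) * w′)
            ≡⟨ cong₂ _+_ (*-distribʳ-sum w (𝟙 ∘ nonmember?)) (*-distribʳ-sum w′ (𝟙 ∘ source? C)) ⟨
          count nonmember? * w + count (source? C) * w′
            ≤⟨ +-monoʳ-≤ (count nonmember? * w) (weight-pred-≤ j≤k at-most-one-source sources≤j) ⟩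
          count nonmember? * w + j * w
            ≡⟨ *-distribʳ-+ w (count nonmember?) j ⟨
          (count nonmember? + j) * w
            ≡⟨ cong (_* w) (count-split free? (_∈? C)) ⟩
          count free? * w
            ≡⟨ cong (count free? *_) (*-identityˡ w) ⟨
          count free? * (1 * w)
            ∎
          where
          at-most-one-source : count (source? C) ≤ 1
          at-most-one-source = count-≤1 (source? C) sources-unique
          j≤k : j ≤ k
          j≤k = ≤-trans (freeIn≤size σ (suc m) C) (≤-reflexive ∣C∣≡k)
          sources≤j : count (source? C) ≤ j
          sources≤j = ∑-mono-≤ λ v →
            𝟙-mono (source? C v) ((v ∈? C) ×-dec free? v) λ (v∈ , v-free , _) → v∈ , v-free

      potential-step : ∃ λ v → potential (moved v) m ≤ potential σ (suc m)
      potential-step = map₂ proj₂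
        (∃-≤-average free? (λ v → potential (moved v) m) (potential σ (suc m)) (v₀ , v₀-free) averaged)
        where
        open ≤-Reasoning
        v₀ : Fin n
        v₀ = σ ⟨$⟩ˡ fromℕ< (≤-trans (s≤s z≤n) m<n)
        v₀-free : position σ v₀ < suc m
        v₀-free = subst (_< suc m) (sym (trans (cong toℕ (P.inverseʳ σ)) (toℕ-fromℕ< _))) (s≤s z≤n)
        C : Fin (numCopiesT G k) → Subset n
        C = List.lookup copies
        averaged : ∑[ v < n ] (𝟙 (free? v) * potential (moved v) m) ≤ count free? * potential σ (suc m)
        averaged = begin
          ∑[ v < n ] (𝟙 (free? v) * potential (moved v) m)
            ≡⟨ sum-cong-≗ {n} (λ v → *-distribˡ-sum (𝟙 (free? v)) (λ i → value (moved v) m (C i))) ⟩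
          ∑[ v < n ] ∑[ i < numCopiesT G k ] (𝟙 (free? v) * value (moved v) m (C i))
            ≡⟨ ∑-comm (λ v i → 𝟙 (free? v) * value (moved v) m (C i)) ⟩
          ∑[ i < numCopiesT G k ] ∑[ v < n ] (𝟙 (free? v) * value (moved v) m (C i))
            ≤⟨ ∑-mono-≤ (λ i → ∑-value-moved≤ (C i) (copy-size i)) ⟩
          ∑[ i < numCopiesT G k ] (count free? * value σ (suc m) (C i))
            ≡⟨ *-distribˡ-sum (count free?) (λ i → value σ (suc m) (C i)) ⟨
          count free? * potential σ (suc m)
            ∎

    potential-descent : ∀ {m} → m ≤ n → ∀ σ → potential σ m < k ! → ∃ λ τ → potential τ 0 < k !
    potential-descent {zero}  _   σ small = σ , small
    potential-descent {suc m} m<n σ small with v , smaller ← Step.potential-step σ m<n =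
      potential-descent (<⇒≤ m<n) (moveTo σ m<n v) (≤-<-trans smaller small)

    potential-id : potential P.id n ≡ numCopiesT G k
    potential-id = trans (sum-cong-≗ {numCopiesT G k} λ i → value-id (copy-size i))
                         (trans (∑-const (numCopiesT G k) 1) (*-identityʳ _))
      where
      value-id : ∀ {C} → ∣ C ∣ ≡ k → value P.id n C ≡ 1
      value-id {C} ∣C∣≡k = begin
        𝟙 (survives? P.id n C) * weight k (freeIn P.id n C)
          ≡⟨ cong₂ _*_ (𝟙-yes (survives? P.id n C) vacuous) (cong (weight k) all-free) ⟩
        1 * weight k k
          ≡⟨ trans (*-identityˡ _) (weight-self k) ⟩
        1 ∎
        where
        open ≡-Reasoning
        vacuous : Survives P.id n C
        vacuous _ v _ _ _ n≤v = contradiction (toℕ<n v) (≤⇒≯ n≤v)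
        all-free : freeIn P.id n C ≡ k
        all-free = trans (sum-cong-≗ {n} λ u → 𝟙-cong ((u ∈? C) ×-dec (toℕ u <? n)) (u ∈? C) proj₁ (_, toℕ<n u))
                         (trans (sym (∣p∣≡count C)) ∣C∣≡k)

    no-backward-copy : ∀ τ → potential τ 0 < k ! → ∀ C → IsCopyOfT G k C → ¬ Backward τ C
    no-backward-copy τ small C copy backward = <⇒≱ small (begin
      k !                          ≡⟨ weight-zero k ⟨
      weight k 0                   ≡⟨ cong (weight k) none-free ⟨
      weight k (freeIn τ 0 C)      ≡⟨ *-identityˡ _ ⟨
      1 * weight k (freeIn τ 0 C)  ≡⟨ cong (_* weight k (freeIn τ 0 C)) (𝟙-yes (survives? τ 0 C) survives) ⟨
      value τ 0 C                  ≡⟨ cong (value τ 0) (lookup-index C∈copies) ⟩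
      value τ 0 (List.lookup copies (index C∈copies))
                                   ≤⟨ term≤∑ (value τ 0 ∘ List.lookup copies) (index C∈copies) ⟩
      potential τ 0                ∎)
      where
      open ≤-Reasoning
      survives : Survives τ 0 C
      survives u v u∈ v∈ u→v _ = backward u v u∈ v∈ u→v
      C∈copies : C ∈ₗ copies
      C∈copies = ∈-filter⁺ (IsCopyOfT? G k) (allSubsets-complete C) copy
      none-free : freeIn τ 0 C ≡ 0
      none-free = trans (sum-cong-≗ {n} λ u → 𝟙-no ((u ∈? C) ×-dec (position τ u <? 0)) λ ()) (∑-zero n)

  ordering-without-backward-copy : ∀ k → numCopiesT G k < k ! →
                                   ∃ λ τ → ∀ C → IsCopyOfT G k C → ¬ Backward τ C
  ordering-without-backward-copy k few =
    map₂ (λ {τ} → no-backward-copy τ) (potential-descent ≤-refl P.id (subst (_< k !) (sym potential-id) few))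
    where open Potential k

  independent⇒backward : ∀ τ {S} → IndependentIn G τ S → Backward τ S
  independent⇒backward τ independent u v u∈ v∈ u→v with <-cmp (position τ u) (position τ v)
  ... | tri< u<v _ _ = contradiction (inj₁ (u→v , u<v)) (independent u v u∈ v∈)
  ... | tri≈ _ u≡v _ with refl ← position-injective τ u≡v = contradiction (subst T (loopless G u) u→v) λ ()
  ... | tri> _ _ v<u = v<u

  backward⇒transitive : ∀ τ {S} → Backward τ S → InducesTransitive G S
  backward⇒transitive τ backward a b c a∈ b∈ c∈ a→b b→c with E G a c in a→c
  ... | true  = _
  ... | false = <-asym (<-trans c<b b<a) (backward c a c∈ a∈ c→a)
    where
    c<b : position τ c < position τ b
    c<b = backward b c b∈ c∈ b→c
    b<a : position τ b < position τ a
    b<a = backward a b a∈ b∈ a→b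
    a≢c : a ≢ c
    a≢c refl = <-asym c<b b<a
    c→a : T (E G c a)
    c→a = subst T (sym (trans (oriented G a c a≢c) (cong not a→c))) _

  independent-size< : ∀ {k} τ → (∀ C → IsCopyOfT G k C → ¬ Backward τ C) →
                      ∀ {S} → IndependentIn G τ S → ∣ S ∣ < k
  independent-size< {k} τ none-backward {S} independent with k ≤? ∣ S ∣
  ... | no  ∣S∣<k = ≰⇒> ∣S∣<k
  ... | yes k≤∣S∣ with C , C⊆S , ∣C∣≡k ← ⊆-of-size S k k≤∣S∣ =
    contradiction backward (none-backward C (∣C∣≡k , backward⇒transitive τ backward))
    where
    backward : Backward τ C
    backward u v u∈ v∈ = independent⇒backward τ independent u v (C⊆S u∈) (C⊆S v∈)

colour-classes-independent : ∀ {m} (G : Tournament n) τ {c : Fin n → Fin m} → ProperColouring G τ m c →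
                             ∀ i → IndependentIn G τ (fibre c i)
colour-classes-independent G τ {c} proper i u v u∈ v∈ adjacent =
  proper u v adjacent (trans (∈-toSubset⁻ (λ u → c u Fin.≟ i) u∈)
                             (sym (∈-toSubset⁻ (λ u → c u Fin.≟ i) v∈)))

lemma2p1 : (n k : ℕ) → 0 < n → 0 < k → (G : Tournament n) →
    numCopiesT G k < k ! →
    Σ (Permutation′ n) (λ π → IndepNumberAtMost G π k × ChromaticAtLeastDiv G π k)
lemma2p1 n k _ _ G few = τ , (λ S → <⇒≤ ∘ small-independent S) , χ≥
  where
  open Orderings G
  τ : Permutation′ n
  τ = proj₁ (ordering-without-backward-copy k few)
  small-independent : ∀ S → IndependentIn G τ S → ∣ S ∣ < k
  small-independent S = independent-size< τ (proj₂ (ordering-without-backward-copy k few))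
  χ≥ : ChromaticAtLeastDiv G τ k
  χ≥ m c proper = fibres≤⇒n≤m*k c λ i →
    <⇒≤ (small-independent (fibre c i) (colour-classes-independent G τ proper i))
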